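{- Let $T$ be a balanced tree. Then $\mathrm{dist}(\ell_1,\ell_2)\neq 4$ for all leaves $\ell_1,\ell_2\in V_0$ if and only if $|N(v)\cap V_1|=1$ for all $v\in V_2$.
   Context: $N(v)$ is the open neighborhood of $v$. A leaf is a vertex of degree 1; the height of a vertex is its minimum distance to a leaf; $V_k$ is the set of vertices of height $k$. A tree is balanced if no two vertices of the same height are adjacent. -}

module Defs where

open import Data.Nat using (ℕ; zero; suc; _+_; _≤_)
open import Data.Fin using (Fin)
open import Data.Bool using (Bool; true; false; if_then_else_)
open import Data.List using (List; []; _∷_; map; allFin)
open import Data.Nat.ListAction using (sum)
open import Data.List.Relation.Unary.Unique.Propositional using (Unique)
open import Data.Product using (Σ; ∃; _×_; _,_)
open import Relation.Binary.PropositionalEquality using (_≡_)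
open import Relation.Nullary using (¬_)
open import Data.Empty using (⊥)

record Graph (n : ℕ) : Set where
  field
    adj     : Fin n → Fin n → Bool
    adj-sym : ∀ u v → adj u v ≡ adj v u
    adj-irr : ∀ v → adj v v ≡ false

module _ {n : ℕ} (G : Graph n) where
  open Graph G

  Adj : Fin n → Fin n → Set
  Adj u v = adj u v ≡ true

  data Walk : Fin n → Fin n → ℕ → Set where
    nil  : ∀ {v} → Walk v v 0
    cons : ∀ {u w v k} → Adj u w → Walk w v k → Walk u v (suc k)

  support : ∀ {u v k} → Walk u v k → List (Fin n)
  support (nil {v})        = v ∷ []
  support (cons {u} _ w)   = u ∷ support w

  tailList : List (Fin n) → List (Fin n)
  tailList []       = []
  tailList (_ ∷ xs) = xs

  IsCycle : ∀ {v k} → Walk v v k → Set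
  IsCycle {k = k} w = 3 ≤ k × Unique (tailList (support w))

  Connected : Set
  Connected = ∀ u v → ∃ λ k → Walk u v k

  Acyclic : Set
  Acyclic = ∀ v k (w : Walk v v k) → ¬ IsCycle w

  -- a tree: nonempty, connected, acyclic
  IsTree : Set
  IsTree = Fin n × Connected × Acyclic

  degree : Fin n → ℕ
  degree v = sum (map (λ w → if adj v w then 1 else 0) (allFin n))

  Leaf : Fin n → Set
  Leaf v = degree v ≡ 1

  Dist : Fin n → Fin n → ℕ → Set
  Dist u v k = Walk u v k × (∀ m → Walk u v m → k ≤ m)

  -- height(v) = k : minimum distance from v to a leaf is k  (v ∈ V_k)
  Height : Fin n → ℕ → Set
  Height v k = (∃ λ ℓ → Leaf ℓ × Dist v ℓ k)
             × (∀ ℓ m → Leaf ℓ → Dist v ℓ m → k ≤ m)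

  Balanced : Set
  Balanced = ∀ u v k → Adj u v → Height u k → Height v k → ⊥

  OneNbrOfHeight1 : Fin n → Set
  OneNbrOfHeight1 v = ∃ λ w → (Adj v w × Height w 1)
                      × (∀ w' → Adj v w' → Height w' 1 → w' ≡ w)

{-# OPTIONS --safe #-}
-- In a balanced graph a neighbour of a leaf is never a leaf, so the vertices
-- of height 1 are exactly the neighbours of leaves, and no two of them are
-- adjacent. Hence leaves hanging at distinct vertices w₁ ≢ w₂ are at distance
-- at least 4, with equality exactly when w₁ and w₂ have a common neighbour,
-- and such a common neighbour has height 2. A vertex of height 2 with two
-- neighbours of height 1 therefore yields two leaves at distance 4, and
-- conversely the middle vertex of a path of length 4 between leaves has height
-- 2 and two distinct neighbours of height 1.
module Submission where

open import Defs
open import Data.Nat using (ℕ; suc; _≤_; z≤n; s≤s)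
open import Data.Nat.Properties using (m+n≡0⇒n≡0; suc-injective)
open import Data.Fin using (Fin; zero; suc; _≟_)
open import Data.Bool using (Bool; true; false; if_then_else_)
open import Data.List using (tabulate)
open import Data.List.Properties using (map-tabulate)
open import Data.Nat.ListAction using (sum)
open import Data.Product using (∃; _×_; _,_; proj₁; proj₂)
open import Data.Empty using (⊥; ⊥-elim)
open import Relation.Nullary using (¬_)
open import Relation.Nullary.Decidable using (decidable-stable)
open import Relation.Binary.PropositionalEquality
  using (_≡_; _≢_; refl; sym; trans; cong)
open import Function using (_∘_; id)

count : ∀ {m} → (Fin m → Bool) → ℕ
count p = sum (tabulate λ i → if p i then 1 else 0)

count-true-head : ∀ {m} (p : Fin (suc m) → Bool) → p zero ≡ true →
  count p ≡ suc (count (p ∘ suc))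
count-true-head p p₀ rewrite p₀ = refl

count≡0⇒false : ∀ {m} (p : Fin m → Bool) {i} → count p ≡ 0 → p i ≢ true
count≡0⇒false p {zero}  c≡0 p₀ with () ← trans (sym (count-true-head p p₀)) c≡0
count≡0⇒false p {suc i} c≡0 pᵢ =
  count≡0⇒false (p ∘ suc) (m+n≡0⇒n≡0 (if p zero then 1 else 0) c≡0) pᵢ

count≡1⇒true-unique : ∀ {m} (p : Fin m → Bool) {i j} →
  count p ≡ 1 → p i ≡ true → p j ≡ true → i ≡ j
count≡1⇒true-unique p {zero}  {zero}  _   _  _  = refl
count≡1⇒true-unique p {zero}  {suc j} c≡1 p₀ pⱼ =
  ⊥-elim (count≡0⇒false (p ∘ suc) (suc-injective (trans (sym (count-true-head p p₀)) c≡1)) pⱼ)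
count≡1⇒true-unique p {suc i} {zero}  c≡1 pᵢ p₀ =
  ⊥-elim (count≡0⇒false (p ∘ suc) (suc-injective (trans (sym (count-true-head p p₀)) c≡1)) pᵢ)
count≡1⇒true-unique p {suc i} {suc j} c≡1 pᵢ pⱼ with p zero
... | true  = ⊥-elim (count≡0⇒false (p ∘ suc) (suc-injective c≡1) pᵢ)
... | false = cong suc (count≡1⇒true-unique (p ∘ suc) c≡1 pᵢ pⱼ)

module _ {n : ℕ} (G : Graph n) where
  open Graph G

  Adj-sym : ∀ {u v} → Adj G u v → Adj G v u
  Adj-sym {u} {v} u~v = trans (adj-sym v u) u~v

  ¬Adj-refl : ∀ {v} → ¬ Adj G v v
  ¬Adj-refl {v} v~v with () ← trans (sym (adj-irr v)) v~v

  degree≡count : ∀ v → degree G v ≡ count (adj v)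
  degree≡count v = cong sum (map-tabulate id (λ w → if adj v w then 1 else 0))

  Leaf⇒neighbour-unique : ∀ {ℓ x y} → Leaf G ℓ → Adj G ℓ x → Adj G ℓ y → x ≡ y
  Leaf⇒neighbour-unique {ℓ} leaf = count≡1⇒true-unique (adj ℓ) (trans (sym (degree≡count ℓ)) leaf)

  Leaf⇒Height0 : ∀ {ℓ} → Leaf G ℓ → Height G ℓ 0
  Leaf⇒Height0 {ℓ} leaf = (ℓ , leaf , nil , λ _ _ → z≤n) , λ _ _ _ _ → z≤n

  Adj⇒Dist1 : ∀ {u v} → Adj G u v → Dist G u v 1
  Adj⇒Dist1 u~v = cons u~v nil , λ where
    _ nil        → ⊥-elim (¬Adj-refl u~v)
    _ (cons _ _) → s≤s z≤n

  Height1-intro : ∀ {v ℓ} → ¬ Leaf G v → Leaf G ℓ → Adj G v ℓ → Height G v 1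
  Height1-intro ¬leaf leaf v~ℓ = (_ , leaf , Adj⇒Dist1 v~ℓ) , λ where
    _ _ leaf′ (nil , _)      → ⊥-elim (¬leaf leaf′)
    _ _ _     (cons _ _ , _) → s≤s z≤n

  Height1⇒leaf-neighbour : ∀ {v} → Height G v 1 → ∃ λ ℓ → Leaf G ℓ × Adj G v ℓ
  Height1⇒leaf-neighbour ((ℓ , leaf , cons v~ℓ nil , _) , _) = ℓ , leaf , v~ℓ

  Height2-intro : ∀ {v ℓ} → ¬ Leaf G v → (∀ {ℓ′} → Leaf G ℓ′ → ¬ Adj G v ℓ′) →
    Leaf G ℓ → Walk G v ℓ 2 → Height G v 2
  Height2-intro {v} ¬leaf ¬near leaf walk =
    (_ , leaf , walk , λ _ → 2≤length leaf) , λ _ _ leaf′ (walk′ , _) → 2≤length leaf′ walk′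
    where
    2≤length : ∀ {ℓ′ m} → Leaf G ℓ′ → Walk G v ℓ′ m → 2 ≤ m
    2≤length leaf′ nil                 = ⊥-elim (¬leaf leaf′)
    2≤length leaf′ (cons v~ℓ′ nil)     = ⊥-elim (¬near leaf′ v~ℓ′)
    2≤length _     (cons _ (cons _ _)) = s≤s (s≤s z≤n)

  module _ (balanced : Balanced G) where

    Balanced⇒leaf-neighbour-Height1 : ∀ {v ℓ} → Leaf G ℓ → Adj G v ℓ → Height G v 1
    Balanced⇒leaf-neighbour-Height1 leaf v~ℓ =
      Height1-intro (λ leafᵥ → balanced _ _ 0 v~ℓ (Leaf⇒Height0 leafᵥ) (Leaf⇒Height0 leaf)) leaf v~ℓ

    distinct-leaf-neighbours⇒4≤length : ∀ {ℓ₁ ℓ₂ w₁ w₂ m} →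
      Leaf G ℓ₁ → Leaf G ℓ₂ → Adj G ℓ₁ w₁ → Adj G ℓ₂ w₂ → w₁ ≢ w₂ →
      Walk G ℓ₁ ℓ₂ m → 4 ≤ m
    distinct-leaf-neighbours⇒4≤length {ℓ₁} {ℓ₂} {w₁} {w₂} leaf₁ leaf₂ ℓ₁~w₁ ℓ₂~w₂ w₁≢w₂ =
      4≤length
      where
      middle-edge : ∀ {x y} → Adj G ℓ₁ x → Adj G x y → Adj G y ℓ₂ → ⊥
      middle-edge ℓ₁~x x~y y~ℓ₂
        with refl ← Leaf⇒neighbour-unique leaf₁ ℓ₁~w₁ ℓ₁~x
           | refl ← Leaf⇒neighbour-unique leaf₂ ℓ₂~w₂ (Adj-sym y~ℓ₂) =
        balanced _ _ 1 x~y (Balanced⇒leaf-neighbour-Height1 leaf₁ (Adj-sym ℓ₁~w₁))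
                           (Balanced⇒leaf-neighbour-Height1 leaf₂ (Adj-sym ℓ₂~w₂))

      4≤length : ∀ {m} → Walk G ℓ₁ ℓ₂ m → 4 ≤ m
      4≤length nil = ⊥-elim (w₁≢w₂ (Leaf⇒neighbour-unique leaf₁ ℓ₁~w₁ ℓ₂~w₂))
      4≤length (cons ℓ₁~ℓ₂ nil) =
        ⊥-elim (balanced _ _ 0 ℓ₁~ℓ₂ (Leaf⇒Height0 leaf₁) (Leaf⇒Height0 leaf₂))
      4≤length (cons ℓ₁~x (cons x~ℓ₂ nil)) =
        ⊥-elim (w₁≢w₂ (trans (Leaf⇒neighbour-unique leaf₁ ℓ₁~w₁ ℓ₁~x)
                             (Leaf⇒neighbour-unique leaf₂ (Adj-sym x~ℓ₂) ℓ₂~w₂)))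
      4≤length (cons ℓ₁~x (cons x~y (cons y~ℓ₂ nil))) = ⊥-elim (middle-edge ℓ₁~x x~y y~ℓ₂)
      4≤length (cons _ (cons _ (cons _ (cons _ _)))) = s≤s (s≤s (s≤s (s≤s z≤n)))

    no-leaves-at-distance-4⇒one-Height1-neighbour :
      (∀ ℓ₁ ℓ₂ → Leaf G ℓ₁ → Leaf G ℓ₂ → ¬ Dist G ℓ₁ ℓ₂ 4) →
      ∀ v → Height G v 2 → OneNbrOfHeight1 G v
    no-leaves-at-distance-4⇒one-Height1-neighbour far v
      ((ℓ , leaf , cons {w = w} v~w (cons w~ℓ nil) , _) , _) =
      w , (v~w , Balanced⇒leaf-neighbour-Height1 leaf w~ℓ) , unique
      where
      unique : ∀ w′ → Adj G v w′ → Height G w′ 1 → w′ ≡ w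
      unique w′ v~w′ height′ = decidable-stable (w′ ≟ w) λ w′≢w →
        let ℓ′ , leaf′ , w′~ℓ′ = Height1⇒leaf-neighbour height′ in
        far ℓ ℓ′ leaf leaf′
          ( cons (Adj-sym w~ℓ) (cons (Adj-sym v~w) (cons v~w′ (cons w′~ℓ′ nil)))
          , λ _ → distinct-leaf-neighbours⇒4≤length leaf leaf′
                    (Adj-sym w~ℓ) (Adj-sym w′~ℓ′) (w′≢w ∘ sym))

    one-Height1-neighbour⇒no-leaves-at-distance-4 :
      (∀ v → Height G v 2 → OneNbrOfHeight1 G v) →
      ∀ ℓ₁ ℓ₂ → Leaf G ℓ₁ → Leaf G ℓ₂ → ¬ Dist G ℓ₁ ℓ₂ 4
    one-Height1-neighbour⇒no-leaves-at-distance-4 one ℓ₁ ℓ₂ leaf₁ leaf₂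
      (cons {w = w₁} ℓ₁~w₁ (cons {w = v} w₁~v (cons {w = w₂} v~w₂ (cons w₂~ℓ₂ nil))) , shortest) =
      w₁≢w₂ (trans (unique w₁ (Adj-sym w₁~v) height₁) (sym (unique w₂ v~w₂ height₂)))
      where
      w₁≢w₂ : w₁ ≢ w₂
      w₁≢w₂ refl with s≤s (s≤s ()) ← shortest 2 (cons ℓ₁~w₁ (cons w₂~ℓ₂ nil))

      height₁ : Height G w₁ 1
      height₁ = Balanced⇒leaf-neighbour-Height1 leaf₁ (Adj-sym ℓ₁~w₁)

      height₂ : Height G w₂ 1
      height₂ = Balanced⇒leaf-neighbour-Height1 leaf₂ w₂~ℓ₂

      ¬leaf : ¬ Leaf G v
      ¬leaf leafᵥ = w₁≢w₂ (Leaf⇒neighbour-unique leafᵥ (Adj-sym w₁~v) v~w₂)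

      ¬near : ∀ {ℓ} → Leaf G ℓ → ¬ Adj G v ℓ
      ¬near leaf v~ℓ = balanced w₁ v 1 w₁~v height₁ (Height1-intro ¬leaf leaf v~ℓ)

      heightᵥ : Height G v 2
      heightᵥ = Height2-intro ¬leaf ¬near leaf₁ (cons (Adj-sym w₁~v) (cons (Adj-sym ℓ₁~w₁) nil))

      unique : ∀ w → Adj G v w → Height G w 1 → w ≡ proj₁ (one v heightᵥ)
      unique = proj₂ (proj₂ (one v heightᵥ))

lemma4p7 : ∀ {n : ℕ} (G : Graph n) → IsTree G → Balanced G →
    ((∀ (ℓ₁ ℓ₂ : Fin n) → Leaf G ℓ₁ → Leaf G ℓ₂ → ¬ Dist G ℓ₁ ℓ₂ 4)
      → (∀ (v : Fin n) → Height G v 2 → OneNbrOfHeight1 G v))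
    × ((∀ (v : Fin n) → Height G v 2 → OneNbrOfHeight1 G v)
      → (∀ (ℓ₁ ℓ₂ : Fin n) → Leaf G ℓ₁ → Leaf G ℓ₂ → ¬ Dist G ℓ₁ ℓ₂ 4))
lemma4p7 G _ balanced =
    no-leaves-at-distance-4⇒one-Height1-neighbour G balanced
  , one-Height1-neighbour⇒no-leaves-at-distance-4 G balanced
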